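{- Suppose that for $1\le i\le t$, $\alpha_i$ is a limit ordinal of finite degree. Then $\mathrm{D}\big(\sum_{i=1}^t\alpha_i\big)\cong\sum_{i=1}^t\mathrm{D}(\alpha_i)$.
   Context: For a linear order $L$, $x\sim_F y$ iff only finitely many points lie between $x$ and $y$; $L/\!\sim_F$ is the ordered set of classes. $\mathrm{D}(\alpha)$ is the ordinal isomorphic to $\alpha/\!\sim_F$. Ordinals of finite degree are those with Cantor normal form $a_n\omega^n+\cdots+a_0$, $n<\omega$. -}

module Defs where

open import Data.Nat as ℕ using (ℕ)
open import Data.Fin as Fin using (Fin; toℕ)
open import Data.Vec using (Vec; []; _∷_)
open import Data.Product using (Σ; ∃; ∃-syntax; _×_; _,_)
open import Data.Sum using (_⊎_)
open import Data.List using (List)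
open import Data.List.Membership.Propositional using (_∈_)
open import Relation.Nullary using (¬_)
open import Function.Bundles using (_⇔_)

record LO : Set₁ where
  field
    Car : Set
    _<_ : Car → Car → Set

-- An ordered set presented as a setoid (used to represent quotient orders
-- L/∼ without quotient types): carrier, equivalence, strict order on classes.
record SO : Set₁ where
  field
    Car : Set
    _≈_ : Car → Car → Set
    _<_ : Car → Car → Set

module _ {t : ℕ} (L : Fin t → LO) where
  private
    C : Fin t → Set
    C i = LO.Car (L i)

  data SumLt : Σ (Fin t) C → Σ (Fin t) C → Set where
    idx : ∀ {i j x y} → i Fin.< j → SumLt (i , x) (j , y)
    inn : ∀ {i x y} → LO._<_ (L i) x y → SumLt (i , x) (i , y)

ΣLO : (t : ℕ) → (Fin t → LO) → LO
ΣLO t L = record { Car = Σ (Fin t) (λ i → LO.Car (L i)) ; _<_ = SumLt L }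

module _ {t : ℕ} (S : Fin t → SO) where
  private
    C : Fin t → Set
    C i = SO.Car (S i)

  data SumSOLt : Σ (Fin t) C → Σ (Fin t) C → Set where
    idx : ∀ {i j x y} → i Fin.< j → SumSOLt (i , x) (j , y)
    inn : ∀ {i x y} → SO._<_ (S i) x y → SumSOLt (i , x) (i , y)

  data SumSOEq : Σ (Fin t) C → Σ (Fin t) C → Set where
    inn : ∀ {i x y} → SO._≈_ (S i) x y → SumSOEq (i , x) (i , y)

ΣSO : (t : ℕ) → (Fin t → SO) → SO
ΣSO t S = record
  { Car = Σ (Fin t) (λ i → SO.Car (S i)) ; _≈_ = SumSOEq S ; _<_ = SumSOLt S }

module _ (L : LO) where
  open LO L

  Between : Car → Car → Car → Set
  Between x y z = (x < z × z < y) ⊎ (y < z × z < x)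

  _∼F_ : Car → Car → Set
  x ∼F y = ∃[ zs ] (∀ z → Between x y z → z ∈ zs)

  Quot : SO
  Quot = record { Car = Car ; _≈_ = _∼F_ ; _<_ = λ x y → x < y × ¬ (x ∼F y) }

-- Order isomorphism between setoid-presented ordered sets
-- (i.e. an isomorphism of the ordered sets of classes).
Iso : SO → SO → Set
Iso A B =
  Σ (SO.Car A → SO.Car B) λ f → ( (∀ x y → (SO._≈_ A x y ⇔ SO._≈_ B (f x) (f y)))
         × (∀ x y → (SO._<_ A x y ⇔ SO._<_ B (f x) (f y)))
         × (∀ b → ∃[ a ] SO._≈_ B (f a) b) )

-- ω^k : vectors of k naturals (n_{k-1}, …, n_0) standing for
-- ω^{k-1}·n_{k-1} + ⋯ + n_0, ordered lexicographically (head most significant).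
data LexLt : {k : ℕ} → Vec ℕ k → Vec ℕ k → Set where
  here  : ∀ {k x y} {xs ys : Vec ℕ k} → x ℕ.< y → LexLt (x ∷ xs) (y ∷ ys)
  there : ∀ {k x} {xs ys : Vec ℕ k} → LexLt xs ys → LexLt (x ∷ xs) (x ∷ ys)

module _ (n : ℕ) (a : Fin (ℕ.suc n) → ℕ) where
  -- The ordinal a_n ω^n + ⋯ + a_1 ω + a_0 (coefficient of ω^k is a k):
  -- an element is (k , c , v): the v-th point of the c-th copy of ω^k.
  OCar : Set
  OCar = Σ (Fin (ℕ.suc n)) (λ k → Fin (a k) × Vec ℕ (toℕ k))

  data OLt : OCar → OCar → Set where
    deg : ∀ {k k' c c' v v'} → toℕ k' ℕ.< toℕ k → OLt (k , c , v) (k' , c' , v')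
    cop : ∀ {k c c' v v'} → c Fin.< c' → OLt (k , c , v) (k , c' , v')
    vec : ∀ {k c v v'} → LexLt v v' → OLt (k , c , v) (k , c , v')

Ord : (n : ℕ) → (Fin (ℕ.suc n) → ℕ) → LO
Ord n a = record { Car = OCar n a ; _<_ = OLt n a }

IsLimit : LO → Set
IsLimit L = LO.Car L × (∀ x → ∃[ y ] LO._<_ L x y)

-- Every summand αᵢ is a limit ordinal, so it has no largest element and above any x in αᵢ
-- lie infinitely many points of αᵢ itself; hence points of different summands of the sum are
-- never at finite distance.  Between two points of the same summand lie only points of that
-- summand, so there ∼F is computed inside αᵢ.  The identity map therefore identifies
-- (Σ αᵢ)/∼F with Σ (αᵢ/∼F).
module Submission where

open import Defs
open import Data.Nat using (ℕ; zero; suc)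
open import Data.Fin using (Fin)

import Data.Nat as ℕ
import Data.Nat.Properties as ℕ
import Data.Fin as Fin
import Data.Fin.Properties as Fin
open import Data.List using (List; []; _∷_; map; length; lookup)
open import Data.List.Relation.Unary.Any using (here; there; index)
open import Data.List.Relation.Unary.Any.Properties using (lookup-index)
open import Data.List.Membership.Propositional using (_∈_)
open import Data.List.Membership.Propositional.Properties using (∈-map⁺)
open import Data.Product using (Σ; ∃-syntax; _×_; _,_; proj₁; proj₂)
open import Data.Sum using (inj₁; inj₂)
open import Data.Empty using (⊥-elim)
open import Function using (_∘_; id)
open import Function.Bundles using (_⇔_; mk⇔)
open import Function.Definitions using (Injective)
open import Relation.Nullary using (¬_; yes; no; contradiction)
open import Relation.Binary.Definitions using (Irreflexive; Transitive; tri<; tri≈; tri>)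
open import Relation.Binary.PropositionalEquality using (_≡_; refl; sym; cong)
open Relation.Binary.PropositionalEquality.≡-Reasoning

injective-not-in-list : ∀ {A : Set} (f : ℕ → A) → Injective _≡_ _≡_ f →
                        (zs : List A) → ¬ (∀ k → f k ∈ zs)
injective-not-in-list f f-inj zs f∈zs
  with i , j , i<j , same-index ← Fin.pigeonhole (ℕ.n<1+n (length zs)) (index ∘ f∈zs ∘ Fin.toℕ)
  = Fin.<-irrefl (Fin.toℕ-injective (f-inj same-point)) i<j
  where
  same-point : f (Fin.toℕ i) ≡ f (Fin.toℕ j)
  same-point = begin
    f (Fin.toℕ i)                       ≡⟨ lookup-index (f∈zs (Fin.toℕ i)) ⟩
    lookup zs (index (f∈zs (Fin.toℕ i))) ≡⟨ cong (lookup zs) same-index ⟩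
    lookup zs (index (f∈zs (Fin.toℕ j))) ≡⟨ sym (lookup-index (f∈zs (Fin.toℕ j))) ⟩
    f (Fin.toℕ j)                       ∎

module _ {A : Set} {_<_ : A → A → Set} (<-irrefl : Irreflexive _≡_ _<_) (<-trans : Transitive _<_)
         (next : ∀ x → ∃[ y ] x < y) where

  climb : A → ℕ → A
  climb x zero    = x
  climb x (suc k) = proj₁ (next (climb x k))

  climb-increasing : ∀ x {k l} → k ℕ.< l → climb x k < climb x l
  climb-increasing x {k} {suc l} (ℕ.s≤s k≤l) with ℕ.m≤n⇒m<n∨m≡n k≤l
  ... | inj₁ k<l  = <-trans (climb-increasing x k<l) (proj₂ (next (climb x l)))
  ... | inj₂ refl = proj₂ (next (climb x k))

  climb-injective : ∀ x → Injective _≡_ _≡_ (climb x)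
  climb-injective x {k} {l} eq with ℕ.<-cmp k l
  ... | tri< k<l _ _ = contradiction (climb-increasing x k<l) (<-irrefl eq)
  ... | tri≈ _ k≡l _ = k≡l
  ... | tri> _ _ l<k = contradiction (climb-increasing x l<k) (<-irrefl (sym eq))

  upper-set-not-in-list : ∀ x (zs : List A) → ¬ (∀ z → x < z → z ∈ zs)
  upper-set-not-in-list x zs above∈zs =
    injective-not-in-list (climb x ∘ suc) (ℕ.suc-injective ∘ climb-injective x) zs
      (λ k → above∈zs _ (climb-increasing x {0} {suc k} (ℕ.s≤s ℕ.z≤n)))

module _ (L : LO) where
  open LO L

  ∼F-sym : ∀ {x y} → _∼F_ L x y → _∼F_ L y x
  ∼F-sym (zs , between∈zs) = zs , λ where
    z (inj₁ x<z<y) → between∈zs z (inj₂ x<z<y)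
    z (inj₂ y<z<x) → between∈zs z (inj₁ y<z<x)

  ∼F-refl : Irreflexive _≡_ _<_ → Transitive _<_ → ∀ x → _∼F_ L x x
  ∼F-refl <-irrefl <-trans x = [] , λ where
    z (inj₁ (x<z , z<x)) → contradiction (<-trans x<z z<x) (<-irrefl refl)
    z (inj₂ (x<z , z<x)) → contradiction (<-trans x<z z<x) (<-irrefl refl)

module _ {t : ℕ} (L : Fin t → LO) where
  private
    C : Fin t → Set
    C i = LO.Car (L i)

    S : LO
    S = ΣLO t L

  component : (i : Fin t) → List (Σ (Fin t) C) → List (C i)
  component i []             = []
  component i ((j , w) ∷ zs) with j Fin.≟ i
  ... | yes refl = w ∷ component i zs
  ... | no _     = component i zs

  ∈-component : ∀ i {w : C i} zs → (i , w) ∈ zs → w ∈ component i zs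
  ∈-component i ((j , _) ∷ zs) w∈zs with j Fin.≟ i | w∈zs
  ... | yes refl | here refl  = here refl
  ... | yes refl | there w∈zs = there (∈-component i zs w∈zs)
  ... | no j≢i   | here refl  = contradiction refl j≢i
  ... | no _     | there w∈zs = ∈-component i zs w∈zs

  squeezed-in-summand : ∀ {i x y z} → SumLt L (i , x) z → SumLt L z (i , y) →
                        ∃[ w ] z ≡ (i , w) × LO._<_ (L i) x w × LO._<_ (L i) w y
  squeezed-in-summand (idx i<j) (idx j<i) = contradiction j<i (Fin.<-asym i<j)
  squeezed-in-summand (idx i<i) (inn _)   = contradiction i<i (Fin.<-irrefl refl)
  squeezed-in-summand (inn _)   (idx i<i) = contradiction i<i (Fin.<-irrefl refl)
  squeezed-in-summand (inn x<w) (inn w<y) = _ , refl , x<w , w<y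

  ∼F-summand⇒ : ∀ i {x y} → _∼F_ S (i , x) (i , y) → _∼F_ (L i) x y
  ∼F-summand⇒ i (zs , between∈zs) = component i zs , λ where
    w (inj₁ (x<w , w<y)) → ∈-component i zs (between∈zs _ (inj₁ (inn x<w , inn w<y)))
    w (inj₂ (y<w , w<x)) → ∈-component i zs (between∈zs _ (inj₂ (inn y<w , inn w<x)))

  ∼F-summand⇐ : ∀ i {x y} → _∼F_ (L i) x y → _∼F_ S (i , x) (i , y)
  ∼F-summand⇐ i {x} {y} (ws , between∈ws) = map (i ,_) ws , between∈image
    where
    between∈image : ∀ z → Between S (i , x) (i , y) z → z ∈ map (i ,_) ws
    between∈image z (inj₁ (x<z , z<y)) with squeezed-in-summand x<z z<y
    ... | w , refl , x<w , w<y = ∈-map⁺ (i ,_) (between∈ws w (inj₁ (x<w , w<y)))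
    between∈image z (inj₂ (y<z , z<x)) with squeezed-in-summand y<z z<x
    ... | w , refl , y<w , w<x = ∈-map⁺ (i ,_) (between∈ws w (inj₂ (y<w , w<x)))

  module _ (<-irrefl : ∀ i → Irreflexive _≡_ (LO._<_ (L i)))
           (<-trans : ∀ i → Transitive (LO._<_ (L i)))
           (next : ∀ i x → ∃[ y ] LO._<_ (L i) x y) where

    -- Every point of summand i above x lies between (i , x) and (j , y).
    ∼F-distinct-summands : ∀ {i j} → i Fin.< j → (x : C i) (y : C j) → ¬ _∼F_ S (i , x) (j , y)
    ∼F-distinct-summands {i} i<j x y (zs , between∈zs) =
      upper-set-not-in-list (<-irrefl i) (<-trans i) (next i) x (component i zs)
        (λ w x<w → ∈-component i zs (between∈zs _ (inj₁ (inn x<w , idx i<j))))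

    ≈-Quot-ΣLO⇔ : ∀ p q → SO._≈_ (Quot S) p q ⇔ SO._≈_ (ΣSO t (Quot ∘ L)) p q
    ≈-Quot-ΣLO⇔ (i , x) (j , y) with Fin.<-cmp i j
    ... | tri< i<j _ _ = mk⇔ (⊥-elim ∘ ∼F-distinct-summands i<j x y)
                             (λ { (inn _) → contradiction i<j (Fin.<-irrefl refl) })
    ... | tri> _ _ j<i = mk⇔ (⊥-elim ∘ ∼F-distinct-summands j<i y x ∘ ∼F-sym S)
                             (λ { (inn _) → contradiction j<i (Fin.<-irrefl refl) })
    ... | tri≈ _ refl _ = mk⇔ (λ x∼y → inn (∼F-summand⇒ i x∼y))
                              (λ { (inn x∼y) → ∼F-summand⇐ i x∼y })

    <-Quot-ΣLO⇔ : ∀ p q → SO._<_ (Quot S) p q ⇔ SO._<_ (ΣSO t (Quot ∘ L)) p q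
    <-Quot-ΣLO⇔ (i , x) (j , y) = mk⇔ to from
      where
      to : SO._<_ (Quot S) (i , x) (j , y) → SO._<_ (ΣSO t (Quot ∘ L)) (i , x) (j , y)
      to (idx i<j , _)   = idx i<j
      to (inn x<y , x≁y) = inn (x<y , x≁y ∘ ∼F-summand⇐ i)
      from : SO._<_ (ΣSO t (Quot ∘ L)) (i , x) (j , y) → SO._<_ (Quot S) (i , x) (j , y)
      from (idx i<j)         = idx i<j , ∼F-distinct-summands i<j x y
      from (inn (x<y , x≁y)) = inn x<y , x≁y ∘ ∼F-summand⇒ i

    Quot-ΣLO-Iso : Iso (Quot (ΣLO t L)) (ΣSO t (Quot ∘ L))
    Quot-ΣLO-Iso = id , ≈-Quot-ΣLO⇔ , <-Quot-ΣLO⇔ ,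
      λ (i , x) → (i , x) , inn (∼F-refl (L i) (<-irrefl i) (<-trans i) x)

LexLt-irrefl : ∀ {k} → Irreflexive _≡_ (LexLt {k})
LexLt-irrefl refl (here x<x)  = ℕ.<-irrefl refl x<x
LexLt-irrefl refl (there v<v) = LexLt-irrefl refl v<v

LexLt-trans : ∀ {k} → Transitive (LexLt {k})
LexLt-trans (here x<y)  (here y<z)  = here (ℕ.<-trans x<y y<z)
LexLt-trans (here x<y)  (there _)   = here x<y
LexLt-trans (there _)   (here y<z)  = here y<z
LexLt-trans (there u<v) (there v<w) = there (LexLt-trans u<v v<w)

module _ (n : ℕ) (a : Fin (suc n) → ℕ) where

  OLt-irrefl : Irreflexive _≡_ (OLt n a)
  OLt-irrefl refl (deg k<k) = ℕ.<-irrefl refl k<k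
  OLt-irrefl refl (cop c<c) = Fin.<-irrefl refl c<c
  OLt-irrefl refl (vec v<v) = LexLt-irrefl refl v<v

  OLt-trans : Transitive (OLt n a)
  OLt-trans (deg p) (deg q) = deg (ℕ.<-trans q p)
  OLt-trans (deg p) (cop _) = deg p
  OLt-trans (deg p) (vec _) = deg p
  OLt-trans (cop _) (deg q) = deg q
  OLt-trans (cop p) (cop q) = cop (Fin.<-trans p q)
  OLt-trans (cop p) (vec _) = cop p
  OLt-trans (vec _) (deg q) = deg q
  OLt-trans (vec _) (cop q) = cop q
  OLt-trans (vec p) (vec q) = vec (LexLt-trans p q)

mainTheorem12 : (t : ℕ) (n : Fin t → ℕ) (a : (i : Fin t) → Fin (suc (n i)) → ℕ)
    → (∀ i → IsLimit (Ord (n i) (a i)))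
    → Iso (Quot (ΣLO t (λ i → Ord (n i) (a i))))
          (ΣSO t (λ i → Quot (Ord (n i) (a i))))
mainTheorem12 t n a limit =
  Quot-ΣLO-Iso (λ i → Ord (n i) (a i))
    (λ i → OLt-irrefl (n i) (a i)) (λ i → OLt-trans (n i) (a i)) (proj₂ ∘ limit)
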